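{- Let $H$ be a hyperplane of a connected modular matroid $M$, and let $B$ be a basis of $H$. If $(X,Y)$ is a partition of $E(M)-H$ and the sets $B$, $X$ and $Y$ are all nonempty, then $M$ has a triangle intersecting each of $X$, $Y$ and $B$.
   Context: A (finite) matroid $M$ is modular if $r_M(F)+r_M(F')=r_M(F\cup F')+r_M(F\cap F')$ for all flats $F,F'$ of $M$. A triangle is a three-element circuit. A hyperplane is a flat of rank $r(M)-1$. -}

module Defs where

open import Data.Nat using (ℕ; _≤_; _<_; _+_; suc)
open import Data.Fin using (Fin)
open import Data.Fin.Subset
  using (Subset; _∈_; _∉_; _⊆_; _∪_; _∩_; _-_; ∁; ⁅_⁆; ∣_∣; ⊤; ⊥; Nonempty)
open import Data.Product using (Σ; ∃; _×_; _,_)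
open import Relation.Binary.PropositionalEquality using (_≡_; _≢_)

record Matroid (n : ℕ) : Set where
  field
    r         : Subset n → ℕ
    r-bound   : ∀ X → r X ≤ ∣ X ∣
    r-mono    : ∀ {X Y} → X ⊆ Y → r X ≤ r Y
    r-submod  : ∀ X Y → r (X ∪ Y) + r (X ∩ Y) ≤ r X + r Y

module _ {n : ℕ} (M : Matroid n) where
  open Matroid M

  rM : ℕ
  rM = r ⊤

  Independent : Subset n → Set
  Independent I = r I ≡ ∣ I ∣

  -- B is a basis of the set X: a maximal independent subset of X,
  -- equivalently an independent subset of X of rank r(X)
  IsBasisOf : Subset n → Subset n → Set
  IsBasisOf B X = B ⊆ X × Independent B × r B ≡ r X

  Circuit : Subset n → Set
  Circuit C = r C < ∣ C ∣ × (∀ e → e ∈ C → Independent (C - e))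

  Triangle : Subset n → Set
  Triangle T = Circuit T × ∣ T ∣ ≡ 3

  Flat : Subset n → Set
  Flat F = ∀ e → e ∉ F → r F < r (F ∪ ⁅ e ⁆)

  Hyperplane : Subset n → Set
  Hyperplane H = Flat H × suc (r H) ≡ rM

  Modular : Set
  Modular = ∀ F F′ → Flat F → Flat F′ → r F + r F′ ≡ r (F ∪ F′) + r (F ∩ F′)

  Connected : Set
  Connected = ∀ e f → e ≢ f → ∃ λ C → Circuit C × e ∈ C × f ∈ C

{-# OPTIONS --safe #-}
-- Work with the closure operator cl of the rank function. Modularity of the flats cl A and cl A′
-- shows that cl A and cl A′ meet whenever r (A ∪ A′) < r A + r A′; in particular two lines in a
-- plane meet. As M is connected, some x ∈ X and y ∈ Y are independent, and the line xy meets
-- H = cl B in a point p. Shrink S ⊆ B, starting from B, while keeping a line xy with x ∈ X, y ∈ Y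
-- that meets cl S: if p ∈ cl S but p ∉ cl (S - b), then either p is parallel to b and {x, y, b}
-- is the triangle, or the line pb meets cl (S - b) in a point q and the coplanar lines xb and yq
-- meet in a point w ∉ H. If w ∈ Y then {x, w, b} is the triangle; if w ∈ X then the line wy
-- meets cl (S - b) in q, and we continue with S - b.
module Submission where

open import Defs
open import Data.Bool.Properties using (T-≡)
open import Data.Fin as Fin using (Fin; _≟_)
open import Data.Fin.Properties using (any?)
open import Data.Fin.Subset
  using (Subset; _∈_; _∉_; _⊆_; _⊂_; _∪_; _∩_; _-_; ∁; ⁅_⁆; ∣_∣; ⊤; ⊥; Nonempty; inside; outside)
open import Data.Fin.Subset.Properties
open import Data.Fin.Subset.Induction using (Acc; acc; ⊂-wellFounded)
open import Data.Nat using (ℕ; zero; suc; _+_; _≤_; _<_; z≤n; s≤s; _≤?_)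
open import Data.Nat.Properties
  using (≤-refl; ≤-reflexive; ≤-trans; ≤-antisym; <-≤-trans; <⇒≱; ≰⇒>; n≤1+n; m≤m+n; +-suc;
         +-comm; +-identityʳ; ≤-pred; <-irrefl; +-mono-≤; +-monoˡ-≤; +-monoʳ-≤; +-cancelʳ-≤; +-monoʳ-<;
         n≤0⇒n≡0; module ≤-Reasoning)
open import Data.Product using (∃; _×_; _,_; proj₁; proj₂)
open import Data.Sum using (_⊎_; inj₁; inj₂; [_,_]′; map₂)
open import Data.Vec using ([]; _∷_; tabulate; there)
open import Data.Vec.Properties using (lookup∘tabulate; lookup⇒[]=; []=⇒lookup)
open import Function using (_∘_; case_of_; Equivalence)
open import Relation.Binary.PropositionalEquality using (_≡_; _≢_; refl; sym; trans; cong; cong₂; subst; ≢-sym)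
open import Relation.Nullary using (¬_; yes; no; isYes; contradiction; ¬?)
open import Relation.Nullary.Decidable using (fromWitness; toWitness; decidable-stable; _×-dec_)
open import Relation.Unary using (Pred; Decidable)

∣p∪q∣≤∣p∣+∣q∣ : ∀ {n} (p q : Subset n) → ∣ p ∪ q ∣ ≤ ∣ p ∣ + ∣ q ∣
∣p∪q∣≤∣p∣+∣q∣ []            []            = z≤n
∣p∪q∣≤∣p∣+∣q∣ (outside ∷ p) (outside ∷ q) = ∣p∪q∣≤∣p∣+∣q∣ p q
∣p∪q∣≤∣p∣+∣q∣ (outside ∷ p) (inside  ∷ q) =
  ≤-trans (s≤s (∣p∪q∣≤∣p∣+∣q∣ p q)) (≤-reflexive (sym (+-suc ∣ p ∣ ∣ q ∣)))
∣p∪q∣≤∣p∣+∣q∣ (inside  ∷ p) (outside ∷ q) = s≤s (∣p∪q∣≤∣p∣+∣q∣ p q)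
∣p∪q∣≤∣p∣+∣q∣ (inside  ∷ p) (inside  ∷ q) =
  s≤s (≤-trans (∣p∪q∣≤∣p∣+∣q∣ p q) (+-monoʳ-≤ ∣ p ∣ (n≤1+n ∣ q ∣)))

x∉p-x : ∀ {n} {p : Subset n} x → x ∉ p - x
x∉p-x {p = _ ∷ _} Fin.zero    ()
x∉p-x {p = _ ∷ _} (Fin.suc x) (there x∈p-x) = x∉p-x x x∈p-x

module _ {n : ℕ} where

  x∈p-y⇒x≢y : ∀ {p : Subset n} {x y} → x ∈ p - y → x ≢ y
  x∈p-y⇒x≢y {x = x} x∈p-x refl = x∉p-x x x∈p-x

  disjoint⇒≢ : ∀ {p q : Subset n} {x y} → p ∩ q ≡ ⊥ → x ∈ p → y ∈ q → x ≢ y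
  disjoint⇒≢ {x = x} p∩q≡⊥ x∈p x∈q refl = ∉⊥ (subst (x ∈_) p∩q≡⊥ (x∈p∩q⁺ (x∈p , x∈q)))

  ∪-⊆ : {p q s : Subset n} → p ⊆ s → q ⊆ s → p ∪ q ⊆ s
  ∪-⊆ {p} {q} p⊆s q⊆s x∈p∪q with x∈p∪q⁻ p q x∈p∪q
  ... | inj₁ x∈p = p⊆s x∈p
  ... | inj₂ x∈q = q⊆s x∈q

  ∪-monoʳ-⊆ : (p : Subset n) {q s : Subset n} → q ⊆ s → p ∪ q ⊆ p ∪ s
  ∪-monoʳ-⊆ p q⊆s = ∪-⊆ (p⊆p∪q _) (⊆-trans q⊆s (q⊆p∪q p _))

  ∪-monoˡ-⊆ : {p q : Subset n} → p ⊆ q → (s : Subset n) → p ∪ s ⊆ q ∪ s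
  ∪-monoˡ-⊆ p⊆q s = ∪-⊆ (⊆-trans p⊆q (p⊆p∪q s)) (q⊆p∪q _ s)

  ⁅x⁆⊆p : {p : Subset n} {x : Fin n} → x ∈ p → ⁅ x ⁆ ⊆ p
  ⁅x⁆⊆p {x = x} x∈p y∈⁅x⁆ = subst (_∈ _) (sym (x∈⁅y⁆⇒x≡y x y∈⁅x⁆)) x∈p

  p⊆[p-x]∪⁅x⁆ : {p : Subset n} {x : Fin n} → p ⊆ (p - x) ∪ ⁅ x ⁆
  p⊆[p-x]∪⁅x⁆ {x = x} {y} y∈p with y ≟ x
  ... | yes refl = x∈p∪q⁺ (inj₂ (x∈⁅x⁆ x))
  ... | no  y≢x  = x∈p∪q⁺ (inj₁ (x∈p∧x≢y⇒x∈p-y y∈p y≢x))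

  ⊆⊎∃∉ : (p q : Subset n) → p ⊆ q ⊎ ∃ λ x → x ∈ p × x ∉ q
  ⊆⊎∃∉ p q with any? (λ x → x ∈? p ×-dec ¬? (x ∈? q))
  ... | yes witness = inj₂ witness
  ... | no  none    = inj₁ λ {x} x∈p → decidable-stable (x ∈? q) (λ x∉q → none (x , x∈p , x∉q))

  -- Not written ⁅ a , b ⁆, which would also parse as ⁅_⁆ applied to the pair (a , b).
  ⟅_,_⟆ : Fin n → Fin n → Subset n
  ⟅ a , b ⟆ = ⁅ a ⁆ ∪ ⁅ b ⁆

  a∈⟅a,b⟆ : ∀ {a b} → a ∈ ⟅ a , b ⟆
  a∈⟅a,b⟆ {a} = x∈p∪q⁺ (inj₁ (x∈⁅x⁆ a))

  b∈⟅a,b⟆ : ∀ {a b} → b ∈ ⟅ a , b ⟆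
  b∈⟅a,b⟆ {b = b} = x∈p∪q⁺ (inj₂ (x∈⁅x⁆ b))

  a∈⟅a,b⟆∪⁅c⁆ : ∀ {a b c} → a ∈ ⟅ a , b ⟆ ∪ ⁅ c ⁆
  a∈⟅a,b⟆∪⁅c⁆ = x∈p∪q⁺ (inj₁ a∈⟅a,b⟆)

  b∈⟅a,b⟆∪⁅c⁆ : ∀ {a b c} → b ∈ ⟅ a , b ⟆ ∪ ⁅ c ⁆
  b∈⟅a,b⟆∪⁅c⁆ = x∈p∪q⁺ (inj₁ b∈⟅a,b⟆)

  c∈⟅a,b⟆∪⁅c⁆ : ∀ {a b c} → c ∈ ⟅ a , b ⟆ ∪ ⁅ c ⁆
  c∈⟅a,b⟆∪⁅c⁆ {c = c} = x∈p∪q⁺ (inj₂ (x∈⁅x⁆ c))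

  ⟅a,b⟆⊆p : ∀ {a b} {p : Subset n} → a ∈ p → b ∈ p → ⟅ a , b ⟆ ⊆ p
  ⟅a,b⟆⊆p a∈p b∈p = ∪-⊆ (⁅x⁆⊆p a∈p) (⁅x⁆⊆p b∈p)

  ⟅a,b⟆≡⟅b,a⟆ : ∀ a b → ⟅ a , b ⟆ ≡ ⟅ b , a ⟆
  ⟅a,b⟆≡⟅b,a⟆ a b = ∪-comm ⁅ a ⁆ ⁅ b ⁆

  filter : ∀ {ℓ} {P : Pred (Fin n) ℓ} → Decidable P → Subset n
  filter P? = tabulate (isYes ∘ P?)

  module _ {ℓ} {P : Pred (Fin n) ℓ} (P? : Decidable P) where

    ∈-filter⁺ : ∀ {x} → P x → x ∈ filter P?
    ∈-filter⁺ {x} px = lookup⇒[]= x _ (trans (lookup∘tabulate _ x) (Equivalence.to T-≡ (fromWitness px)))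

    ∈-filter⁻ : ∀ {x} → x ∈ filter P? → P x
    ∈-filter⁻ {x} x∈ =
      toWitness (Equivalence.from T-≡ (trans (sym (lookup∘tabulate _ x)) ([]=⇒lookup x∈)))

module MatroidProperties {n : ℕ} (M : Matroid n) where
  open Matroid M

  r-⊥ : r ⊥ ≡ 0
  r-⊥ = n≤0⇒n≡0 (≤-trans (r-bound ⊥) (≤-reflexive (∣⊥∣≡0 n)))

  r-⁅⁆≤1 : ∀ e → r ⁅ e ⁆ ≤ 1
  r-⁅⁆≤1 e = ≤-trans (r-bound ⁅ e ⁆) (≤-reflexive (∣⁅x⁆∣≡1 e))

  r-⟅a,b⟆≡r-⟅b,a⟆ : ∀ a b → r ⟅ a , b ⟆ ≡ r ⟅ b , a ⟆
  r-⟅a,b⟆≡r-⟅b,a⟆ a b = cong r (⟅a,b⟆≡⟅b,a⟆ a b)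

  r-subadditive : ∀ A A′ → r (A ∪ A′) ≤ r A + r A′
  r-subadditive A A′ = ≤-trans (m≤m+n _ _) (r-submod A A′)

  r-⟅⟆≤2 : ∀ a b → r ⟅ a , b ⟆ ≤ 2
  r-⟅⟆≤2 a b = ≤-trans (r-subadditive ⁅ a ⁆ ⁅ b ⁆) (+-mono-≤ (r-⁅⁆≤1 a) (r-⁅⁆≤1 b))

  r-∪-no-gain : ∀ {A P Q} → A ⊆ P → A ⊆ Q → r P ≤ r A → r (P ∪ Q) ≤ r Q
  r-∪-no-gain {A} {P} {Q} A⊆P A⊆Q rP≤rA = +-cancelʳ-≤ (r A) (r (P ∪ Q)) (r Q) (begin
    r (P ∪ Q) + r A        ≤⟨ +-monoʳ-≤ (r (P ∪ Q)) (r-mono (λ e∈A → x∈p∩q⁺ (A⊆P e∈A , A⊆Q e∈A))) ⟩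
    r (P ∪ Q) + r (P ∩ Q)  ≤⟨ r-submod P Q ⟩
    r P + r Q              ≤⟨ +-monoˡ-≤ (r Q) rP≤rA ⟩
    r A + r Q              ≡⟨ +-comm (r A) (r Q) ⟩
    r Q + r A              ∎)
    where open ≤-Reasoning

  opaque
    cl : Subset n → Subset n
    cl A = filter (λ e → r (A ∪ ⁅ e ⁆) ≤? r A)

    ∈-cl⁺ : ∀ {A e} → r (A ∪ ⁅ e ⁆) ≤ r A → e ∈ cl A
    ∈-cl⁺ {A} = ∈-filter⁺ (λ e → r (A ∪ ⁅ e ⁆) ≤? r A)

    ∈-cl⁻ : ∀ {A e} → e ∈ cl A → r (A ∪ ⁅ e ⁆) ≤ r A
    ∈-cl⁻ {A} = ∈-filter⁻ (λ e → r (A ∪ ⁅ e ⁆) ≤? r A)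

  ⊆-cl : ∀ {A} → A ⊆ cl A
  ⊆-cl e∈A = ∈-cl⁺ (r-mono (∪-⊆ ⊆-refl (⁅x⁆⊆p e∈A)))

  a∈cl⟅a,b⟆ : ∀ {a b} → a ∈ cl ⟅ a , b ⟆
  a∈cl⟅a,b⟆ = ⊆-cl a∈⟅a,b⟆

  b∈cl⟅a,b⟆ : ∀ {a b} → b ∈ cl ⟅ a , b ⟆
  b∈cl⟅a,b⟆ = ⊆-cl b∈⟅a,b⟆

  cl-mono : ∀ {A A′} → A ⊆ A′ → cl A ⊆ cl A′
  cl-mono {A} {A′} A⊆A′ {e} e∈clA =
    ∈-cl⁺ (≤-trans (r-mono (∪-⊆ (q⊆p∪q (A ∪ ⁅ e ⁆) A′) (⊆-trans (q⊆p∪q A ⁅ e ⁆) (p⊆p∪q A′))))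
                   (r-∪-no-gain (p⊆p∪q ⁅ e ⁆) A⊆A′ (∈-cl⁻ e∈clA)))

  r-∪-cl : ∀ {A} S → S ⊆ cl A → r (A ∪ S) ≤ r A
  r-∪-cl {A} S = go S (⊂-wellFounded S)
    where
    go : ∀ S → Acc _⊂_ S → S ⊆ cl A → r (A ∪ S) ≤ r A
    go S _ S⊆clA with nonempty? S
    go S _ S⊆clA | no S-empty =
      ≤-reflexive (cong r (trans (cong (A ∪_) (Empty-unique S-empty)) (∪-identityʳ A)))
    go S (acc smaller) S⊆clA | yes (e , e∈S) = begin
      r (A ∪ S)                  ≤⟨ r-mono (⊆-trans (∪-monoʳ-⊆ A p⊆[p-x]∪⁅x⁆) (⊆-reflexive (sym (∪-assoc A _ _)))) ⟩
      r ((A ∪ (S - e)) ∪ ⁅ e ⁆)  ≤⟨ ∈-cl⁻ (cl-mono (p⊆p∪q (S - e)) (S⊆clA e∈S)) ⟩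
      r (A ∪ (S - e))            ≤⟨ go (S - e) (smaller (x∈p⇒p-x⊂p e∈S)) (S⊆clA ∘ p─q⊆p S ⁅ e ⁆) ⟩
      r A                        ∎
      where open ≤-Reasoning

  r-cl : ∀ A → r (cl A) ≡ r A
  r-cl A = ≤-antisym (≤-trans (r-mono (q⊆p∪q A (cl A))) (r-∪-cl (cl A) ⊆-refl)) (r-mono ⊆-cl)

  cl-flat : ∀ A → Flat M (cl A)
  cl-flat A e e∉clA = begin-strict
    r (cl A)          ≡⟨ r-cl A ⟩
    r A               <⟨ ≰⇒> (e∉clA ∘ ∈-cl⁺) ⟩
    r (A ∪ ⁅ e ⁆)     ≤⟨ r-mono (∪-monoˡ-⊆ ⊆-cl ⁅ e ⁆) ⟩
    r (cl A ∪ ⁅ e ⁆)  ∎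
    where open ≤-Reasoning

  cl-⊆-flat : ∀ {A F} → Flat M F → A ⊆ F → cl A ⊆ F
  cl-⊆-flat {A} {F} F-flat A⊆F {e} e∈clA with e ∈? F
  ... | yes e∈F = e∈F
  ... | no  e∉F = contradiction (∈-cl⁻ (cl-mono A⊆F e∈clA)) (<⇒≱ (F-flat e e∉F))

  cl-⊆ : ∀ {A A′} → A ⊆ cl A′ → cl A ⊆ cl A′
  cl-⊆ {A′ = A′} = cl-⊆-flat (cl-flat A′)

  cl-exchange : ∀ {A A′} → A ⊆ cl A′ → r A′ ≤ r A → A′ ⊆ cl A
  cl-exchange {A} {A′} A⊆clA′ rA′≤rA {e} e∈A′ = ∈-cl⁺ (begin
    r (A ∪ ⁅ e ⁆)  ≤⟨ r-mono (∪-⊆ A⊆clA′ (⁅x⁆⊆p (⊆-cl e∈A′))) ⟩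
    r (cl A′)      ≡⟨ r-cl A′ ⟩
    r A′           ≤⟨ rA′≤rA ⟩
    r A            ∎)
    where open ≤-Reasoning

  module _ (modular : Modular M) where

    r-cl-∩ : ∀ A A′ → r A + r A′ ≤ r (A ∪ A′) + r (cl A ∩ cl A′)
    r-cl-∩ A A′ = begin
      r A + r A′                            ≡⟨ sym (cong₂ _+_ (r-cl A) (r-cl A′)) ⟩
      r (cl A) + r (cl A′)                  ≡⟨ modular (cl A) (cl A′) (cl-flat A) (cl-flat A′) ⟩
      r (cl A ∪ cl A′) + r (cl A ∩ cl A′)   ≤⟨ +-monoˡ-≤ _ (r-mono cl-∪⊆cl-∪) ⟩
      r (cl (A ∪ A′)) + r (cl A ∩ cl A′)    ≡⟨ cong (_+ r (cl A ∩ cl A′)) (r-cl (A ∪ A′)) ⟩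
      r (A ∪ A′) + r (cl A ∩ cl A′)         ∎
      where
      open ≤-Reasoning
      cl-∪⊆cl-∪ : cl A ∪ cl A′ ⊆ cl (A ∪ A′)
      cl-∪⊆cl-∪ = ∪-⊆ (cl-mono (p⊆p∪q A′)) (cl-mono (q⊆p∪q A A′))

    cl-∩-nonempty : ∀ A A′ → r (A ∪ A′) < r A + r A′ → Nonempty (cl A ∩ cl A′)
    cl-∩-nonempty A A′ rank-drop with nonempty? (cl A ∩ cl A′)
    ... | yes meet = meet
    ... | no  empty = contradiction (r-cl-∩ A A′) (<⇒≱ (begin-strict
      r (A ∪ A′) + r (cl A ∩ cl A′)  ≡⟨ cong (λ S → r (A ∪ A′) + r S) (Empty-unique empty) ⟩
      r (A ∪ A′) + r ⊥               ≡⟨ cong (r (A ∪ A′) +_) r-⊥ ⟩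
      r (A ∪ A′) + 0                 ≡⟨ +-identityʳ (r (A ∪ A′)) ⟩
      r (A ∪ A′)                     <⟨ rank-drop ⟩
      r A + r A′                     ∎))
      where open ≤-Reasoning

  loop-∈-cl : ∀ {A e} → r ⁅ e ⁆ ≡ 0 → e ∈ cl A
  loop-∈-cl {A} {e} loop = ∈-cl⁺ (begin
    r (A ∪ ⁅ e ⁆)    ≤⟨ r-subadditive A ⁅ e ⁆ ⟩
    r A + r ⁅ e ⁆    ≡⟨ cong (r A +_) loop ⟩
    r A + 0          ≡⟨ +-identityʳ (r A) ⟩
    r A              ∎)
    where open ≤-Reasoning

  independent-∉-cl : ∀ {I e} → Independent M I → e ∈ I → e ∉ cl (I - e)
  independent-∉-cl {I} {e} I-independent e∈I e∈cl = <⇒≱ ∣I-e∣<rI (begin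
    r I                  ≤⟨ r-mono p⊆[p-x]∪⁅x⁆ ⟩
    r ((I - e) ∪ ⁅ e ⁆)  ≤⟨ ∈-cl⁻ e∈cl ⟩
    r (I - e)            ≤⟨ r-bound (I - e) ⟩
    ∣ I - e ∣            ∎)
    where
    open ≤-Reasoning
    ∣I-e∣<rI : ∣ I - e ∣ < r I
    ∣I-e∣<rI = subst (∣ I - e ∣ <_) (sym I-independent) (x∈p⇒∣p-x∣<∣p∣ e∈I)

  circuit-∈-cl : ∀ {C e} → Circuit M C → e ∈ C → e ∈ cl (C - e)
  circuit-∈-cl {C} {e} (dependent , minimal) e∈C = ∈-cl⁺ (≤-pred (begin-strict
    r ((C - e) ∪ ⁅ e ⁆)    ≤⟨ r-mono (∪-⊆ (p─q⊆p C ⁅ e ⁆) (⁅x⁆⊆p e∈C)) ⟩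
    r C                    <⟨ dependent ⟩
    ∣ C ∣                  ≤⟨ p⊆q⇒∣p∣≤∣q∣ (p⊆[p-x]∪⁅x⁆ {p = C} {x = e}) ⟩
    ∣ (C - e) ∪ ⁅ e ⁆ ∣    ≤⟨ ∣p∪q∣≤∣p∣+∣q∣ (C - e) ⁅ e ⁆ ⟩
    ∣ C - e ∣ + ∣ ⁅ e ⁆ ∣  ≡⟨ cong₂ _+_ (sym (minimal e e∈C)) (∣⁅x⁆∣≡1 e) ⟩
    r (C - e) + 1          ≡⟨ +-comm (r (C - e)) 1 ⟩
    suc (r (C - e))        ∎))
    where open ≤-Reasoning

  circuit-nonloop : ∀ {C e f} → Circuit M C → e ∈ C → f ∈ C → e ≢ f → 1 ≤ r ⁅ e ⁆
  circuit-nonloop {C} {e} {f} (_ , minimal) e∈C f∈C e≢f with r ⁅ e ⁆ in r⁅e⁆≡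
  ... | zero  = contradiction (loop-∈-cl r⁅e⁆≡)
                  (independent-∉-cl (minimal f f∈C) (x∈p∧x≢y⇒x∈p-y e∈C e≢f))
  ... | suc _ = s≤s z≤n

  connected⇒loopless : Connected M → ∀ {a b} → a ≢ b → ∀ e → 1 ≤ r ⁅ e ⁆
  connected⇒loopless connected {a} {b} a≢b e with e ≟ a
  ... | yes refl = let C , C-circuit , e∈C , b∈C = connected e b a≢b in circuit-nonloop C-circuit e∈C b∈C a≢b
  ... | no  e≢a  = let C , C-circuit , e∈C , a∈C = connected e a e≢a in circuit-nonloop C-circuit e∈C a∈C e≢a

  circuit-leaves-flat : ∀ {C F e} → Circuit M C → Flat M F → e ∈ C → e ∉ F →
                        ∃ λ f → f ∈ C - e × f ∉ F
  circuit-leaves-flat {C} {F} {e} C-circuit F-flat e∈C e∉F with ⊆⊎∃∉ (C - e) F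
  ... | inj₁ C-e⊆F  = contradiction (cl-⊆-flat F-flat C-e⊆F (circuit-∈-cl C-circuit e∈C)) e∉F
  ... | inj₂ escape = escape

  independent-pair⇒≢ : ∀ {a b} → 2 ≤ r ⟅ a , b ⟆ → a ≢ b
  independent-pair⇒≢ {a} 2≤r refl =
    <-irrefl refl (≤-trans 2≤r (≤-trans (≤-reflexive (cong r (∪-idem ⁅ a ⁆))) (r-⁅⁆≤1 a)))

  independent-pair-⊆-minus : ∀ {a b e p} → 2 ≤ r ⟅ a , b ⟆ → a ∈ p → b ∈ p → a ≢ e → b ≢ e →
                             2 ≤ r (p - e)
  independent-pair-⊆-minus 2≤r a∈p b∈p a≢e b≢e =
    ≤-trans 2≤r (r-mono (⟅a,b⟆⊆p (x∈p∧x≢y⇒x∈p-y a∈p a≢e) (x∈p∧x≢y⇒x∈p-y b∈p b≢e)))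

  triangle : ∀ {a b c} → 2 ≤ r ⟅ a , b ⟆ → 2 ≤ r ⟅ a , c ⟆ → 2 ≤ r ⟅ b , c ⟆ → c ∈ cl ⟅ a , b ⟆ →
             Triangle M (⟅ a , b ⟆ ∪ ⁅ c ⁆)
  triangle {a} {b} {c} ab ac bc c∈cl = (rT<∣T∣ , T-e-independent) , ∣T∣≡3
    where
    T : Subset n
    T = ⟅ a , b ⟆ ∪ ⁅ c ⁆
    a∈T : a ∈ T
    a∈T = a∈⟅a,b⟆∪⁅c⁆
    b∈T : b ∈ T
    b∈T = b∈⟅a,b⟆∪⁅c⁆
    c∈T : c ∈ T
    c∈T = c∈⟅a,b⟆∪⁅c⁆

    2≤r[T-e] : ∀ e → 2 ≤ r (T - e)
    2≤r[T-e] e with e ≟ a | e ≟ b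
    ... | yes refl | _        = independent-pair-⊆-minus bc b∈T c∈T (≢-sym (independent-pair⇒≢ ab))
                                                                    (≢-sym (independent-pair⇒≢ ac))
    ... | no e≢a   | yes refl = independent-pair-⊆-minus ac a∈T c∈T (independent-pair⇒≢ ab)
                                                                    (≢-sym (independent-pair⇒≢ bc))
    ... | no e≢a   | no e≢b   = independent-pair-⊆-minus ab a∈T b∈T (≢-sym e≢a) (≢-sym e≢b)

    ∣T∣≤3 : ∣ T ∣ ≤ 3
    ∣T∣≤3 = begin
      ∣ T ∣                            ≤⟨ ∣p∪q∣≤∣p∣+∣q∣ ⟅ a , b ⟆ ⁅ c ⁆ ⟩
      ∣ ⟅ a , b ⟆ ∣ + ∣ ⁅ c ⁆ ∣        ≤⟨ +-monoˡ-≤ _ (∣p∪q∣≤∣p∣+∣q∣ ⁅ a ⁆ ⁅ b ⁆) ⟩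
      ∣ ⁅ a ⁆ ∣ + ∣ ⁅ b ⁆ ∣ + ∣ ⁅ c ⁆ ∣ ≡⟨ cong₂ _+_ (cong₂ _+_ (∣⁅x⁆∣≡1 a) (∣⁅x⁆∣≡1 b)) (∣⁅x⁆∣≡1 c) ⟩
      3                                ∎
      where open ≤-Reasoning

    2≤∣T-e∣ : ∀ e → 2 ≤ ∣ T - e ∣
    2≤∣T-e∣ e = ≤-trans (2≤r[T-e] e) (r-bound (T - e))

    ∣T∣≡3 : ∣ T ∣ ≡ 3
    ∣T∣≡3 = ≤-antisym ∣T∣≤3 (<-≤-trans (s≤s (2≤∣T-e∣ c)) (x∈p⇒∣p-x∣<∣p∣ c∈T))

    T-e-independent : ∀ e → e ∈ T → Independent M (T - e)
    T-e-independent e e∈T = ≤-antisym (r-bound (T - e))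
      (≤-trans (≤-pred (<-≤-trans (x∈p⇒∣p-x∣<∣p∣ e∈T) ∣T∣≤3)) (2≤r[T-e] e))

    rT<∣T∣ : r T < ∣ T ∣
    rT<∣T∣ = begin-strict
      r T             ≤⟨ r-mono (∪-⊆ ⊆-cl (⁅x⁆⊆p c∈cl)) ⟩
      r (cl ⟅ a , b ⟆) ≡⟨ r-cl ⟅ a , b ⟆ ⟩
      r ⟅ a , b ⟆      ≤⟨ r-⟅⟆≤2 a b ⟩
      2               <⟨ ≤-refl ⟩
      3               ≡⟨ sym ∣T∣≡3 ⟩
      ∣ T ∣           ∎
      where open ≤-Reasoning

  parallel⇒dependent : ∀ {a b} → b ∈ cl ⁅ a ⁆ → ¬ 2 ≤ r ⟅ a , b ⟆
  parallel⇒dependent {a} b∈cl⁅a⁆ 2≤r = <-irrefl refl (≤-trans 2≤r (≤-trans (∈-cl⁻ b∈cl⁅a⁆) (r-⁅⁆≤1 a)))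

  line-meets-flat-in-point : ∀ {A F e u v} → Flat M F → r A ≤ 2 → e ∈ cl A → e ∉ F →
                             u ∈ cl A → v ∈ cl A → u ∈ F → v ∈ F → ¬ 2 ≤ r ⟅ u , v ⟆
  line-meets-flat-in-point {F = F} {u = u} {v = v} F-flat rA≤2 e∈clA e∉F u∈clA v∈clA u∈F v∈F 2≤r⟅u,v⟆ =
    e∉F (cl-⊆-flat F-flat ⟅u,v⟆⊆F (cl-⊆ (cl-exchange (⟅a,b⟆⊆p u∈clA v∈clA) (≤-trans rA≤2 2≤r⟅u,v⟆)) e∈clA))
    where
    ⟅u,v⟆⊆F : ⟅ u , v ⟆ ⊆ F
    ⟅u,v⟆⊆F = ⟅a,b⟆⊆p u∈F v∈F

  module _ (loopless : ∀ e → 1 ≤ r ⁅ e ⁆) where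

    ∉-cl-⊥ : ∀ {e} → e ∉ cl ⊥
    ∉-cl-⊥ {e} e∈cl = contradiction (begin
      1               ≤⟨ loopless e ⟩
      r ⁅ e ⁆         ≡⟨ cong r (sym (∪-identityˡ ⁅ e ⁆)) ⟩
      r (⊥ ∪ ⁅ e ⁆)   ≤⟨ ∈-cl⁻ e∈cl ⟩
      r ⊥             ≡⟨ r-⊥ ⟩
      0               ∎) λ ()
      where open ≤-Reasoning

    dependent⇒parallel : ∀ {a b} → ¬ 2 ≤ r ⟅ a , b ⟆ → b ∈ cl ⁅ a ⁆
    dependent⇒parallel {a} dependent = ∈-cl⁺ (≤-trans (≤-pred (≰⇒> dependent)) (loopless a))

    nonparallel⇒independent : ∀ {a b} → b ∉ cl ⁅ a ⁆ → 2 ≤ r ⟅ a , b ⟆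
    nonparallel⇒independent b∉cl⁅a⁆ = decidable-stable (2 ≤? _) (b∉cl⁅a⁆ ∘ dependent⇒parallel)

    parallel-sym : ∀ {a b} → b ∈ cl ⁅ a ⁆ → a ∈ cl ⁅ b ⁆
    parallel-sym {a} {b} b∈cl⁅a⁆ = ∈-cl⁺ (begin
      r ⟅ b , a ⟆  ≡⟨ r-⟅a,b⟆≡r-⟅b,a⟆ b a ⟩
      r ⟅ a , b ⟆  ≤⟨ ∈-cl⁻ b∈cl⁅a⁆ ⟩
      r ⁅ a ⁆      ≤⟨ r-⁅⁆≤1 a ⟩
      1            ≤⟨ loopless b ⟩
      r ⁅ b ⁆      ∎)
      where open ≤-Reasoning

    independent⇒independent-pair : ∀ {I a b} → Independent M I → a ∈ I → b ∈ I → a ≢ b → 2 ≤ r ⟅ a , b ⟆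
    independent⇒independent-pair I-independent a∈I b∈I a≢b = nonparallel⇒independent λ b∈cl⁅a⁆ →
      independent-∉-cl I-independent b∈I (cl-mono (⁅x⁆⊆p (x∈p∧x≢y⇒x∈p-y a∈I a≢b)) b∈cl⁅a⁆)

    ∉flat⇒independent : ∀ {F a e} → Flat M F → e ∉ F → a ∈ F → 2 ≤ r ⟅ e , a ⟆
    ∉flat⇒independent F-flat e∉F a∈F = nonparallel⇒independent λ a∈cl⁅e⁆ →
      e∉F (cl-⊆-flat F-flat (⁅x⁆⊆p a∈F) (parallel-sym a∈cl⁅e⁆))

module CrossingTriangles {n : ℕ} (M : Matroid n) (modular : Modular M)
  (loopless : ∀ e → 1 ≤ Matroid.r M ⁅ e ⁆)
  {H B X Y : Subset n} (H-flat : Flat M H) (B⊆H : B ⊆ H) (X∪Y≡∁H : X ∪ Y ≡ ∁ H) where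

  open Matroid M
  open MatroidProperties M

  CrossingTriangle : Set
  CrossingTriangle = ∃ λ T → Triangle M T × Nonempty (T ∩ X) × Nonempty (T ∩ Y) × Nonempty (T ∩ B)

  -- Invariant of the descent: the line through x ∈ X and y ∈ Y meets cl S in the point p.
  record CrossingLine (S : Subset n) : Set where
    constructor crossingLine
    field
      x y p       : Fin n
      x∈X         : x ∈ X
      y∈Y         : y ∈ Y
      independent : 2 ≤ r ⟅ x , y ⟆
      p∈cl⟅x,y⟆    : p ∈ cl ⟅ x , y ⟆
      p∈cl-S      : p ∈ cl S

  ∈X⇒∉H : ∀ {e} → e ∈ X → e ∉ H
  ∈X⇒∉H e∈X = x∈∁p⇒x∉p (subst (_ ∈_) X∪Y≡∁H (x∈p∪q⁺ (inj₁ e∈X)))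

  ∈Y⇒∉H : ∀ {e} → e ∈ Y → e ∉ H
  ∈Y⇒∉H e∈Y = x∈∁p⇒x∉p (subst (_ ∈_) X∪Y≡∁H (x∈p∪q⁺ (inj₂ e∈Y)))

  ∉H⇒∈X⊎∈Y : ∀ {e} → e ∉ H → e ∈ X ⊎ e ∈ Y
  ∉H⇒∈X⊎∈Y e∉H = x∈p∪q⁻ X Y (subst (_ ∈_) (sym X∪Y≡∁H) (x∉p⇒x∈∁p e∉H))

  toCrossingTriangle : ∀ {a b c} → Triangle M (⟅ a , b ⟆ ∪ ⁅ c ⁆) →
                       ∀ {x y z} → x ∈ ⟅ a , b ⟆ ∪ ⁅ c ⁆ → y ∈ ⟅ a , b ⟆ ∪ ⁅ c ⁆ → z ∈ ⟅ a , b ⟆ ∪ ⁅ c ⁆ →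
                       x ∈ X → y ∈ Y → z ∈ B → CrossingTriangle
  toCrossingTriangle T-triangle x∈T y∈T z∈T x∈X y∈Y z∈B =
    _ , T-triangle , (_ , x∈p∩q⁺ (x∈T , x∈X)) , (_ , x∈p∩q⁺ (y∈T , y∈Y)) , (_ , x∈p∩q⁺ (z∈T , z∈B))

  module Step {S b x y p} (S⊆H : S ⊆ H) (b∈B : b ∈ B) (x∈X : x ∈ X) (y∈Y : y ∈ Y)
              (xy : 2 ≤ r ⟅ x , y ⟆) (p∈cl⟅x,y⟆ : p ∈ cl ⟅ x , y ⟆)
              (p∈cl[S+b] : p ∈ cl (S ∪ ⁅ b ⁆)) (p∉cl-S : p ∉ cl S) where

    b∈H : b ∈ H
    b∈H = B⊆H b∈B

    p∈H : p ∈ H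
    p∈H = cl-⊆-flat H-flat (∪-⊆ S⊆H (⁅x⁆⊆p b∈H)) p∈cl[S+b]

    x∉H : x ∉ H
    x∉H = ∈X⇒∉H x∈X

    y∉H : y ∉ H
    y∉H = ∈Y⇒∉H y∈Y

    xb : 2 ≤ r ⟅ x , b ⟆
    xb = ∉flat⇒independent loopless H-flat x∉H b∈H

    b∥p⇒triangle : b ∈ cl ⁅ p ⁆ → CrossingTriangle
    b∥p⇒triangle b∈cl⁅p⁆ = toCrossingTriangle
      (triangle xy xb (∉flat⇒independent loopless H-flat y∉H b∈H) (cl-⊆ (⁅x⁆⊆p p∈cl⟅x,y⟆) b∈cl⁅p⁆))
      a∈⟅a,b⟆∪⁅c⁆ b∈⟅a,b⟆∪⁅c⁆ c∈⟅a,b⟆∪⁅c⁆ x∈X y∈Y b∈B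

    module _ (pb : 2 ≤ r ⟅ p , b ⟆) where

      -- pb ∪ S lies in cl (S ∪ b), whose rank is at most r S + 1.
      q-exists : Nonempty (cl ⟅ p , b ⟆ ∩ cl S)
      q-exists = cl-∩-nonempty modular ⟅ p , b ⟆ S (begin-strict
        r (⟅ p , b ⟆ ∪ S)     ≤⟨ r-mono (∪-⊆ (⟅a,b⟆⊆p p∈cl[S+b] b∈cl[S+b]) (⊆-trans (p⊆p∪q ⁅ b ⁆) ⊆-cl)) ⟩
        r (cl (S ∪ ⁅ b ⁆))    ≡⟨ r-cl (S ∪ ⁅ b ⁆) ⟩
        r (S ∪ ⁅ b ⁆)         ≤⟨ r-subadditive S ⁅ b ⁆ ⟩
        r S + r ⁅ b ⁆         ≤⟨ +-monoʳ-≤ (r S) (r-⁅⁆≤1 b) ⟩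
        r S + 1               <⟨ +-monoʳ-< (r S) ≤-refl ⟩
        r S + 2               ≤⟨ +-monoʳ-≤ (r S) pb ⟩
        r S + r ⟅ p , b ⟆     ≡⟨ +-comm (r S) _ ⟩
        r ⟅ p , b ⟆ + r S     ∎)
        where
        open ≤-Reasoning
        b∈cl[S+b] : b ∈ cl (S ∪ ⁅ b ⁆)
        b∈cl[S+b] = ⊆-cl (q⊆p∪q S ⁅ b ⁆ (x∈⁅x⁆ b))

      q : Fin n
      q = proj₁ q-exists

      q∈cl⟅p,b⟆ : q ∈ cl ⟅ p , b ⟆
      q∈cl⟅p,b⟆ = proj₁ (x∈p∩q⁻ _ _ (proj₂ q-exists))

      q∈cl-S : q ∈ cl S
      q∈cl-S = proj₂ (x∈p∩q⁻ _ _ (proj₂ q-exists))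

      q∈H : q ∈ H
      q∈H = cl-⊆-flat H-flat S⊆H q∈cl-S

      qp : 2 ≤ r ⟅ q , p ⟆
      qp = nonparallel⇒independent loopless λ p∈cl⁅q⁆ → p∉cl-S (cl-⊆ (⁅x⁆⊆p q∈cl-S) p∈cl⁅q⁆)

      -- All of x, b, y, q lie in the rank-3 flat spanned by x, y, b, so the lines xb and yq meet.
      w-exists : Nonempty (cl ⟅ x , b ⟆ ∩ cl ⟅ y , q ⟆)
      w-exists = cl-∩-nonempty modular ⟅ x , b ⟆ ⟅ y , q ⟆ (begin-strict
        r (⟅ x , b ⟆ ∪ ⟅ y , q ⟆)  ≤⟨ r-mono (∪-⊆ (⟅a,b⟆⊆p (⊆-cl x∈P) (⊆-cl b∈P)) (⟅a,b⟆⊆p (⊆-cl y∈P) q∈clP)) ⟩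
        r (cl P)                  ≡⟨ r-cl P ⟩
        r P                       ≤⟨ r-subadditive ⟅ x , y ⟆ ⁅ b ⁆ ⟩
        r ⟅ x , y ⟆ + r ⁅ b ⁆      ≤⟨ +-mono-≤ (r-⟅⟆≤2 x y) (r-⁅⁆≤1 b) ⟩
        3                         <⟨ ≤-refl ⟩
        4                         ≤⟨ +-mono-≤ xb (∉flat⇒independent loopless H-flat y∉H q∈H) ⟩
        r ⟅ x , b ⟆ + r ⟅ y , q ⟆  ∎)
        where
        open ≤-Reasoning
        P : Subset n
        P = ⟅ x , y ⟆ ∪ ⁅ b ⁆
        x∈P : x ∈ P
        x∈P = a∈⟅a,b⟆∪⁅c⁆
        y∈P : y ∈ P
        y∈P = b∈⟅a,b⟆∪⁅c⁆
        b∈P : b ∈ P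
        b∈P = c∈⟅a,b⟆∪⁅c⁆
        q∈clP : q ∈ cl P
        q∈clP = cl-⊆ (⟅a,b⟆⊆p (cl-mono (p⊆p∪q ⁅ b ⁆) p∈cl⟅x,y⟆) (⊆-cl b∈P)) q∈cl⟅p,b⟆

      w : Fin n
      w = proj₁ w-exists

      w∈cl⟅x,b⟆ : w ∈ cl ⟅ x , b ⟆
      w∈cl⟅x,b⟆ = proj₁ (x∈p∩q⁻ _ _ (proj₂ w-exists))

      w∈cl⟅y,q⟆ : w ∈ cl ⟅ y , q ⟆
      w∈cl⟅y,q⟆ = proj₂ (x∈p∩q⁻ _ _ (proj₂ w-exists))

      -- A point of H on both lines would be parallel to b and to q, putting b, hence p, in cl S.
      w∉H : w ∉ H
      w∉H w∈H = p∉cl-S (cl-⊆ (∪-⊆ ⊆-cl (⁅x⁆⊆p b∈cl-S)) p∈cl[S+b])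
        where
        parallel-on-line : ∀ {e u} → e ∉ H → u ∈ H → w ∈ cl ⟅ e , u ⟆ → u ∈ cl ⁅ w ⁆
        parallel-on-line {e} {u} e∉H u∈H w∈cl⟅e,u⟆ = dependent⇒parallel loopless
          (line-meets-flat-in-point H-flat (r-⟅⟆≤2 e u) a∈cl⟅a,b⟆ e∉H w∈cl⟅e,u⟆ b∈cl⟅a,b⟆ w∈H u∈H)
        b∈cl-S : b ∈ cl S
        b∈cl-S = cl-⊆ (⁅x⁆⊆p (cl-⊆ (⁅x⁆⊆p q∈cl-S) (parallel-sym loopless (parallel-on-line y∉H q∈H w∈cl⟅y,q⟆))))
                      (parallel-on-line x∉H b∈H w∈cl⟅x,b⟆)

      xw : 2 ≤ r ⟅ x , w ⟆
      xw = nonparallel⇒independent loopless λ w∈cl⁅x⁆ →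
        let x∈cl⟅y,q⟆ = cl-⊆ (⁅x⁆⊆p w∈cl⟅y,q⟆) (parallel-sym loopless w∈cl⁅x⁆)
            p∈cl⟅y,q⟆ = cl-⊆ (⟅a,b⟆⊆p x∈cl⟅y,q⟆ a∈cl⟅a,b⟆) p∈cl⟅x,y⟆
        in line-meets-flat-in-point H-flat (r-⟅⟆≤2 y q) x∈cl⟅y,q⟆ x∉H b∈cl⟅a,b⟆ p∈cl⟅y,q⟆ q∈H p∈H qp

      wy : 2 ≤ r ⟅ w , y ⟆
      wy = nonparallel⇒independent loopless λ y∈cl⁅w⁆ →
        let y∈cl⟅x,b⟆ = cl-⊆ (⁅x⁆⊆p w∈cl⟅x,b⟆) y∈cl⁅w⁆
            p∈cl⟅x,b⟆ = cl-⊆ (⟅a,b⟆⊆p a∈cl⟅a,b⟆ y∈cl⟅x,b⟆) p∈cl⟅x,y⟆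
        in line-meets-flat-in-point H-flat (r-⟅⟆≤2 x b) a∈cl⟅a,b⟆ x∉H p∈cl⟅x,b⟆ b∈cl⟅a,b⟆ p∈H b∈H pb

      w∈Y⇒triangle : w ∈ Y → CrossingTriangle
      w∈Y⇒triangle w∈Y = toCrossingTriangle
        (triangle xb xw
                  (subst (2 ≤_) (r-⟅a,b⟆≡r-⟅b,a⟆ w b) (∉flat⇒independent loopless H-flat w∉H b∈H))
                  w∈cl⟅x,b⟆)
        a∈⟅a,b⟆∪⁅c⁆ c∈⟅a,b⟆∪⁅c⁆ b∈⟅a,b⟆∪⁅c⁆ x∈X w∈Y b∈B

      w∈X⇒line : w ∈ X → CrossingLine S
      w∈X⇒line w∈X = crossingLine w y q w∈X y∈Y wy
        (cl-exchange (⟅a,b⟆⊆p w∈cl⟅y,q⟆ a∈cl⟅a,b⟆) (≤-trans (r-⟅⟆≤2 y q) wy) b∈⟅a,b⟆) q∈cl-S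

      step-nonparallel : CrossingTriangle ⊎ CrossingLine S
      step-nonparallel = [ inj₂ ∘ w∈X⇒line , inj₁ ∘ w∈Y⇒triangle ]′ (∉H⇒∈X⊎∈Y w∉H)

    step : CrossingTriangle ⊎ CrossingLine S
    step = case b ∈? cl ⁅ p ⁆ of λ where
      (yes b∈cl⁅p⁆) → inj₁ (b∥p⇒triangle b∈cl⁅p⁆)
      (no  b∉cl⁅p⁆) → step-nonparallel (nonparallel⇒independent loopless b∉cl⁅p⁆)

  descend : ∀ {S} → S ⊆ B → CrossingLine S → CrossingTriangle ⊎ ∃ λ S′ → S′ ⊂ S × CrossingLine S′
  descend {S} S⊆B (crossingLine x y p x∈X y∈Y xy p∈cl⟅x,y⟆ p∈cl-S) with nonempty? S
  ... | no S-empty = contradiction (subst (λ S → p ∈ cl S) (Empty-unique S-empty) p∈cl-S) (∉-cl-⊥ loopless)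
  ... | yes (b , b∈S) with p ∈? cl (S - b)
  ...   | yes p∈cl[S-b] = inj₂ (S - b , x∈p⇒p-x⊂p b∈S , crossingLine x y p x∈X y∈Y xy p∈cl⟅x,y⟆ p∈cl[S-b])
  ...   | no  p∉cl[S-b] = map₂ (λ line → S - b , x∈p⇒p-x⊂p b∈S , line)
                            (Step.step (⊆-trans (p─q⊆p S ⁅ b ⁆) (⊆-trans S⊆B B⊆H)) (S⊆B b∈S) x∈X y∈Y xy
                                       p∈cl⟅x,y⟆ (cl-mono p⊆[p-x]∪⁅x⁆ p∈cl-S) p∉cl[S-b])

  crossingLine⇒triangle : ∀ {S} → S ⊆ B → CrossingLine S → CrossingTriangle
  crossingLine⇒triangle {S} = go (⊂-wellFounded S)
    where
    go : ∀ {S} → Acc _⊂_ S → S ⊆ B → CrossingLine S → CrossingTriangle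
    go (acc smaller) S⊆B line with descend S⊆B line
    ... | inj₁ T                     = T
    ... | inj₂ (S′ , S′⊂S , line′) = go (smaller S′⊂S) (⊆-trans (p⊂q⇒p⊆q S′⊂S) S⊆B) line′

  CrossingPair : Set
  CrossingPair = ∃ λ x → ∃ λ y → x ∈ X × y ∈ Y × 2 ≤ r ⟅ x , y ⟆

  crossing-pair-from : ∀ {x f} → x ∈ X → Nonempty Y → f ∉ H → 2 ≤ r ⟅ x , f ⟆ → CrossingPair
  crossing-pair-from {x} {f} x∈X (y , y∈Y) f∉H xf with ∉H⇒∈X⊎∈Y f∉H | 2 ≤? r ⟅ x , y ⟆
  ... | inj₂ f∈Y | _             = x , f , x∈X , f∈Y , xf
  ... | inj₁ _   | yes xy        = x , y , x∈X , y∈Y , xy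
  ... | inj₁ f∈X | no  dependent = f , y , f∈X , y∈Y , nonparallel⇒independent loopless λ y∈cl⁅f⁆ →
    parallel⇒dependent (cl-⊆ (⁅x⁆⊆p (dependent⇒parallel loopless dependent)) (parallel-sym loopless y∈cl⁅f⁆)) xf

  -- A circuit through x ∈ X and b ∈ B leaves H at some f ≠ x, and x, f are independent in C - b.
  crossing-pair : Connected M → Nonempty X → Nonempty Y → Nonempty B → CrossingPair
  crossing-pair connected (x , x∈X) neY (b , b∈B) =
    let C , C-circuit , x∈C , b∈C = connected x b (∉H⇒≢b x∉H)
        f , f∈C-x , f∉H = circuit-leaves-flat C-circuit H-flat x∈C x∉H
    in crossing-pair-from x∈X neY f∉H
         (independent⇒independent-pair loopless (proj₂ C-circuit b b∈C)
           (x∈p∧x≢y⇒x∈p-y x∈C (∉H⇒≢b x∉H)) (x∈p∧x≢y⇒x∈p-y (p─q⊆p C ⁅ x ⁆ f∈C-x) (∉H⇒≢b f∉H))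
           (≢-sym (x∈p-y⇒x≢y f∈C-x)))
    where
    x∉H : x ∉ H
    x∉H = ∈X⇒∉H x∈X
    ∉H⇒≢b : ∀ {e} → e ∉ H → e ≢ b
    ∉H⇒≢b e∉H refl = e∉H (B⊆H b∈B)

  crossingLine-B : Connected M → suc (r H) ≡ rM M → IsBasisOf M B H →
                   Nonempty X → Nonempty Y → Nonempty B → CrossingLine B
  crossingLine-B connected H-corank (_ , _ , rB≡rH) neX neY neB =
    let x , y , x∈X , y∈Y , xy = crossing-pair connected neX neY neB
        p , p∈cl⟅x,y⟆∩clH = cl-∩-nonempty modular ⟅ x , y ⟆ H (rank-drop xy)
    in crossingLine x y p x∈X y∈Y xy (proj₁ (x∈p∩q⁻ _ _ p∈cl⟅x,y⟆∩clH))
                                     (cl-⊆ H⊆cl-B (proj₂ (x∈p∩q⁻ _ _ p∈cl⟅x,y⟆∩clH)))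
    where
    H⊆cl-B : H ⊆ cl B
    H⊆cl-B = cl-exchange (⊆-trans B⊆H ⊆-cl) (≤-reflexive (sym rB≡rH))
    rank-drop : ∀ {x y} → 2 ≤ r ⟅ x , y ⟆ → r (⟅ x , y ⟆ ∪ H) < r ⟅ x , y ⟆ + r H
    rank-drop {x} {y} xy = begin-strict
      r (⟅ x , y ⟆ ∪ H)   ≤⟨ r-mono ⊆⊤ ⟩
      r ⊤                 ≡⟨ sym H-corank ⟩
      1 + r H             <⟨ ≤-refl ⟩
      2 + r H             ≤⟨ +-monoˡ-≤ (r H) xy ⟩
      r ⟅ x , y ⟆ + r H   ∎
      where open ≤-Reasoning

lemma4p6 : ∀ {n : ℕ} (M : Matroid n) → Connected M → Modular M →
           (H B X Y : Subset n) → Hyperplane M H → IsBasisOf M B H →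
           X ∩ Y ≡ ⊥ → X ∪ Y ≡ ∁ H →
           Nonempty B → Nonempty X → Nonempty Y →
           ∃ λ T → Triangle M T × Nonempty (T ∩ X) × Nonempty (T ∩ Y) × Nonempty (T ∩ B)
lemma4p6 M connected modular H B X Y (H-flat , H-corank) B-basis X∩Y≡⊥ X∪Y≡∁H neB neX neY =
  crossingLine⇒triangle ⊆-refl (crossingLine-B connected H-corank B-basis neX neY neB)
  where
  open MatroidProperties M using (connected⇒loopless)
  loopless : ∀ e → 1 ≤ Matroid.r M ⁅ e ⁆
  loopless = connected⇒loopless connected (disjoint⇒≢ X∩Y≡⊥ (proj₂ neX) (proj₂ neY))
  open CrossingTriangles M modular loopless H-flat (proj₁ B-basis) X∪Y≡∁H
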